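{- Let $u,k$ be integers with $0\le u\le k$, $k\ge 1$ and $\gcd(u,k)=1$. Then there is exactly one fundamental Bhaskara pair $\{a,b\}$ with $b$ a positive integer and $a/b=u/k$. This pair is given explicitly as follows. For each prime $p$, let - $c_p$ be the exponent of $p$ in $u^2+k^2$, - $d_p$ be the exponent of $p$ in $u^3+k^3$, - $k_p$ be the exponent of $p$ in $k$. Define $T(c,d)$ for $c\in\{0,1,2\}$ and $d\in\{0,1\}$ by $$T(0,0)=0,\quad T(0,1)=3,\quad T(1,0)=4,\quad T(1,1)=1,\quad T(2,0)=2,\quad T(2,1)=5.$$ Then $$b=\prod_p p^{\,k_p+T(c_p \bmod 3,\; d_p \bmod 2)}\qquad\text{and}\qquad a=ub/k.$$ Here $k\mid b$, so $a$ is an integer.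
   Context: A Bhaskara pair is a pair $\{a,b\}$ of integers for which there exist integers $x,y$ with $a^2+b^2=x^3$ and $a^3+b^3=y^2$. A Bhaskara pair $\{a,b\}$ is called fundamental if there is no prime $p$ such that $p^6\mid a$ and $p^6\mid b$. -}

module Defs where

open import Data.Nat as ℕ using (ℕ; zero; suc)
open import Data.Nat.Primality using (Prime)
import Data.Nat.Divisibility as ℕD
open import Data.Integer using (ℤ; +_; _+_; _*_; _^_)
open import Data.Integer.Divisibility using (_∣_)
open import Data.Product using (∃; ∃-syntax; _×_)
open import Relation.Binary.PropositionalEquality using (_≡_)
open import Relation.Nullary using (¬_)

BhaskaraPair : ℤ → ℤ → Set
BhaskaraPair a b = ∃[ x ] ∃[ y ] ((a ^ 2 + b ^ 2 ≡ x ^ 3) × (a ^ 3 + b ^ 3 ≡ y ^ 2))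

Fundamental : ℤ → ℤ → Set
Fundamental a b = ¬ (∃[ p ] (Prime p × ((+ p) ^ 6 ∣ a) × ((+ p) ^ 6 ∣ b)))

FundamentalBhaskaraPair : ℤ → ℤ → Set
FundamentalBhaskaraPair a b = BhaskaraPair a b × Fundamental a b

IsExponent : ℕ → ℕ → ℕ → Set
IsExponent p e n = (p ℕ.^ e ℕD.∣ n) × ¬ (p ℕ.^ suc e ℕD.∣ n)

-- The table T(c,d) for c ∈ {0,1,2}, d ∈ {0,1}  (other arguments never used).
T : ℕ → ℕ → ℕ
T 0 0 = 0
T 0 1 = 3
T 1 0 = 4
T 1 1 = 1
T 2 0 = 2
T 2 1 = 5
T _ _ = 0

{-# OPTIONS --safe #-}
module Submission where

-- Since gcd u k = 1, a pair with a/b = u/k and b > 0 is (u t, k t) for a positive integer t.  It is a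
-- Bhaskara pair iff t² (u² + k²) is a cube and t³ (u³ + k³) is a square, and fundamental iff t is
-- sixth-power free, as gcd (u t) (k t) = t.  For such t the exponent v < 6 of a prime p satisfies
-- 2v + c ≡ 0 (mod 3) and 3v + d ≡ 0 (mod 2), which forces v = T (c mod 3, d mod 2); so t is unique.
-- It exists because t = (u² + k²)⁴ (u³ + k³)³ satisfies both power conditions and dividing out a
-- sixth power preserves them.

open import Defs

module _ where
  open import Data.Nat
  open import Data.Nat.Properties
  open import Data.Nat.Divisibility
  open import Data.Nat.Primality
  open import Data.Nat.Primality.Factorisation using (factorise)
  open import Data.Nat.GCD using (gcd[m,n]∣m; gcd[m,n]∣n; gcd-greatest)
  open import Data.Nat.Induction using (<-rec)
  open import Data.Nat.DivMod
  open import Data.Nat.Tactic.RingSolver using (solve-∀)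
  open import Data.Nat.Solver using (module +-*-Solver)
  open +-*-Solver using (solve; _:*_; _:^_; _:=_)
  open import Data.List using ([]; _∷_)
  open import Data.Nat.ListAction using (product)
  open import Data.List.Relation.Unary.All using (_∷_)
  open import Data.Product using (∃-syntax; _×_; _,_; proj₁; proj₂)
  open import Data.Sum using (inj₁; inj₂)
  open import Relation.Nullary using (¬_; yes; no; contradiction)
  open import Relation.Nullary.Decidable using (_×-dec_)
  open import Relation.Binary.PropositionalEquality

  private variable p e f g k m n s t z : ℕ

  prime-divisor : ∀ n → 1 < n → ∃[ p ] Prime p × p ∣ n
  prime-divisor 1 (s≤s ())
  prime-divisor n@(suc (suc _)) _ with factorise n
  ... | record { factors = p ∷ ps ; isFactorisation = n≡p*ps ; factorsPrime = pp ∷ _ } =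
    p , pp , divides (product ps) (trans n≡p*ps (*-comm p (product ps)))
  ... | record { factors = [] ; isFactorisation = () }

  ^-monoʳ-∣ : ∀ p → m ≤ n → p ^ m ∣ p ^ n
  ^-monoʳ-∣ p z≤n       = 1∣ _
  ^-monoʳ-∣ p (s≤s m≤n) = *-monoʳ-∣ p (^-monoʳ-∣ p m≤n)

  ^-monoˡ-∣ : ∀ k → m ∣ n → m ^ k ∣ n ^ k
  ^-monoˡ-∣ zero    m∣n = ∣-refl
  ^-monoˡ-∣ (suc k) m∣n = *-pres-∣ m∣n (^-monoˡ-∣ k m∣n)

  *-^-distrib : ∀ m n k → (m * n) ^ k ≡ m ^ k * n ^ k
  *-^-distrib m n zero    = refl
  *-^-distrib m n (suc k) = trans (cong (m * n *_) (*-^-distrib m n k))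
                                  ([m*n]*[o*p]≡[m*o]*[n*p] m n (m ^ k) (n ^ k))

  scaled-power-sum : ∀ n u k s → (u * s) ^ n + (k * s) ^ n ≡ s ^ n * (u ^ n + k ^ n)
  scaled-power-sum n u k s = begin
    (u * s) ^ n + (k * s) ^ n      ≡⟨ cong₂ _+_ (*-^-distrib u s n) (*-^-distrib k s n) ⟩
    u ^ n * s ^ n + k ^ n * s ^ n  ≡⟨ *-distribʳ-+ (s ^ n) (u ^ n) (k ^ n) ⟨
    (u ^ n + k ^ n) * s ^ n        ≡⟨ *-comm (u ^ n + k ^ n) (s ^ n) ⟩
    s ^ n * (u ^ n + k ^ n)        ∎
    where open ≡-Reasoning

  isExponent⇒nonZero : IsExponent p e n → NonZero n
  isExponent⇒nonZero {n = zero}  (_ , p^1+e∤0) = contradiction (_ ∣0) p^1+e∤0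
  isExponent⇒nonZero {n = suc n} _             = _

  isExponent-∣ : IsExponent p e n → g ≤ e → p ^ g ∣ n
  isExponent-∣ {p} (p^e∣n , _) g≤e = ∣-trans (^-monoʳ-∣ p g≤e) p^e∣n

  isExponent-maximal : IsExponent p e n → p ^ g ∣ n → g ≤ e
  isExponent-maximal {p} {e} {g = g} (_ , p^1+e∤n) p^g∣n with g ≤? e
  ... | yes g≤e = g≤e
  ... | no  g≰e = contradiction (∣-trans (^-monoʳ-∣ p (≰⇒> g≰e)) p^g∣n) p^1+e∤n

  isExponent-unique : IsExponent p e n → IsExponent p f n → e ≡ f
  isExponent-unique e-exp f-exp =
    ≤-antisym (isExponent-maximal f-exp (proj₁ e-exp)) (isExponent-maximal e-exp (proj₁ f-exp))

  module _ (pp : Prime p) where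
    private
      instance
        p≢0 : NonZero p
        p≢0 = prime⇒nonZero pp
        p>1 : NonTrivial p
        p>1 = prime⇒nonTrivial pp

    exponent-exists : ∀ n → .{{NonZero n}} → ∃[ e ] IsExponent p e n
    exponent-exists = <-rec _ step
      where
      step : ∀ n → (∀ {m} → m < n → .{{NonZero m}} → ∃[ e ] IsExponent p e m) →
             .{{NonZero n}} → ∃[ e ] IsExponent p e n
      step n rec with p ∣? n
      ... | no p∤n = 0 , 1∣ n , λ p*1∣n → p∤n (subst (_∣ n) (*-identityʳ p) p*1∣n)
      ... | yes p∣n with rec (quotient-< p∣n) {{quotient≢0 p∣n}}
      ...   | e , p^e∣q , p^1+e∤q =
        suc e , subst (_ ∣_) (sym n≡p*q) (*-monoʳ-∣ p p^e∣q) ,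
        λ p^2+e∣n → p^1+e∤q (*-cancelˡ-∣ p (subst (_ ∣_) n≡p*q p^2+e∣n))
        where
        n≡p*q : n ≡ p * quotient p∣n
        n≡p*q = m∣n⇒n≡m*quotient p∣n

    isExponent-1 : IsExponent p 0 1
    isExponent-1 = ∣-refl , λ p*1∣1 → >⇒≢ (nonTrivial⇒n>1 p) (trans (sym (*-identityʳ p)) (∣1⇒≡1 p*1∣1))

    exponent-cofactor : IsExponent p e n → ∃[ m ] n ≡ p ^ e * m × ¬ p ∣ m
    exponent-cofactor {e} {n} (divides m n≡m*p^e , p^1+e∤n) = m , n≡p^e*m , p∤m
      where
      n≡p^e*m : n ≡ p ^ e * m
      n≡p^e*m = trans n≡m*p^e (*-comm m (p ^ e))
      p∤m : ¬ p ∣ m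
      p∤m p∣m = p^1+e∤n (subst₂ _∣_ (*-comm (p ^ e) p) (sym n≡p^e*m) (*-monoʳ-∣ (p ^ e) p∣m))

    isExponent-* : IsExponent p e m → IsExponent p f n → IsExponent p (e + f) (m * n)
    isExponent-* {e} {m} {f} {n} e-exp f-exp with exponent-cofactor {e} e-exp | exponent-cofactor {f} f-exp
    ... | m′ , m≡p^e*m′ , p∤m′ | n′ , n≡p^f*n′ , p∤n′ =
      subst (_∣ m * n) (sym (^-distribˡ-+-* p e f)) (*-pres-∣ (proj₁ e-exp) (proj₁ f-exp)) ,
      λ p^1+e+f∣mn → p∤m′n′ (*-cancelˡ-∣ (p ^ (e + f)) {{m^n≢0 p (e + f)}}
                              (subst₂ _∣_ (*-comm p (p ^ (e + f))) mn≡p^[e+f]*m′n′ p^1+e+f∣mn))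
      where
      open ≡-Reasoning
      mn≡p^[e+f]*m′n′ : m * n ≡ p ^ (e + f) * (m′ * n′)
      mn≡p^[e+f]*m′n′ = begin
        m * n                         ≡⟨ cong₂ _*_ m≡p^e*m′ n≡p^f*n′ ⟩
        (p ^ e * m′) * (p ^ f * n′)   ≡⟨ [m*n]*[o*p]≡[m*o]*[n*p] (p ^ e) m′ (p ^ f) n′ ⟩
        (p ^ e * p ^ f) * (m′ * n′)   ≡⟨ cong (_* (m′ * n′)) (^-distribˡ-+-* p e f) ⟨
        p ^ (e + f) * (m′ * n′)       ∎
      p∤m′n′ : ¬ p ∣ m′ * n′
      p∤m′n′ p∣m′n′ with euclidsLemma m′ n′ pp p∣m′n′
      ... | inj₁ p∣m′ = p∤m′ p∣m′
      ... | inj₂ p∣n′ = p∤n′ p∣n′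

    isExponent-^ : IsExponent p e n → ∀ k → IsExponent p (k * e) (n ^ k)
    isExponent-^ e-exp zero    = isExponent-1
    isExponent-^ {e} e-exp (suc k) = isExponent-* {e} e-exp (isExponent-^ e-exp k)

  -- If m ∤ n, then m / gcd m n has a prime factor p, and p divides m more often than it divides gcd m n.
  prime-powers-∣⇒∣ : .{{NonZero m}} → (∀ {p e} → Prime p → p ^ e ∣ m → p ^ e ∣ n) → m ∣ n
  prime-powers-∣⇒∣ {m} {n} prime-powers-∣ with gcd[m,n]∣m m n
  ... | divides 0 m≡0*g = contradiction m≡0*g (≢-nonZero⁻¹ m)
  ... | divides 1 m≡1*g = subst (_∣ n) (sym (trans m≡1*g (*-identityˡ _))) (gcd[m,n]∣n m n)
  ... | divides q@(suc (suc _)) m≡q*g with prime-divisor q (s≤s (s≤s z≤n))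
  ...   | p , pp , p∣q with exponent-exists pp m
  ...     | e , p^e∣m , p^1+e∤m =
    contradiction (subst (_ ∣_) (sym m≡q*g) (*-pres-∣ p∣q (gcd-greatest p^e∣m (prime-powers-∣ {e = e} pp p^e∣m))))
                  p^1+e∤m

  m^k∣n^k⇒m∣n : ∀ k .{{_ : NonZero k}} .{{_ : NonZero m}} → m ^ k ∣ n ^ k → m ∣ n
  m^k∣n^k⇒m∣n {m} {zero}      k _       = m ∣0
  m^k∣n^k⇒m∣n {m} {n@(suc _)} k m^k∣n^k = prime-powers-∣⇒∣ λ {p} {e} pp p^e∣m →
    let f , f-exp = exponent-exists pp n
        p^ek∣n^k : p ^ (e * k) ∣ n ^ k
        p^ek∣n^k = subst (_∣ n ^ k) (^-*-assoc p e k) (∣-trans (^-monoˡ-∣ k p^e∣m) m^k∣n^k)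
        ek≤kf : e * k ≤ k * f
        ek≤kf = isExponent-maximal (isExponent-^ pp {f} f-exp k) p^ek∣n^k
    in isExponent-∣ f-exp (*-cancelʳ-≤ e f k (subst (e * k ≤_) (*-comm k f) ek≤kf))

  IsPower : ℕ → ℕ → Set
  IsPower k n = ∃[ x ] n ≡ x ^ k

  ^-nonZero⁻¹ : ∀ k .{{_ : NonZero k}} m → .{{NonZero (m ^ k)}} → NonZero m
  ^-nonZero⁻¹ (suc k) (suc m) = _

  isPower-cancelʳ : ∀ k .{{_ : NonZero k}} .{{_ : NonZero z}} → IsPower k (n * z ^ k) → IsPower k n
  isPower-cancelʳ {z} {n} k (x , nz^k≡x^k) = q , *-cancelʳ-≡ n (q ^ k) (z ^ k) {{m^n≢0 z k}} (begin
    n * z ^ k      ≡⟨ nz^k≡x^k ⟩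
    x ^ k          ≡⟨ cong (_^ k) (m∣n⇒n≡quotient*m z∣x) ⟩
    (q * z) ^ k    ≡⟨ *-^-distrib q z k ⟩
    q ^ k * z ^ k  ∎)
    where
    open ≡-Reasoning
    z∣x : z ∣ x
    z∣x = m^k∣n^k⇒m∣n k (divides n (sym nz^k≡x^k))
    q : ℕ
    q = quotient z∣x

  isPower⇒∣exponent : ∀ k .{{_ : NonZero k}} → Prime p → IsPower k n → IsExponent p e n → k ∣ e
  isPower⇒∣exponent {p} {n} {e} k pp (x , n≡x^k) e-exp =
    divides v (trans (isExponent-unique {p} {e} e-exp kv-exp) (*-comm k v))
    where
    instance
      x≢0 : NonZero x
      x≢0 = ^-nonZero⁻¹ k x {{subst NonZero n≡x^k (isExponent⇒nonZero {p} {e} e-exp)}}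
    v : ℕ
    v = proj₁ (exponent-exists pp x)
    kv-exp : IsExponent p (k * v) n
    kv-exp = subst (IsExponent p (k * v)) (sym n≡x^k) (isExponent-^ pp {v} (proj₂ (exponent-exists pp x)) k)

  %-complement : ∀ n .{{_ : NonZero n}} m c → n ∣ m + c → c % n ≡ (n ∸ m % n) % n
  %-complement n m c (divides q m+c≡q*n) = begin
    c % n                        ≡⟨ [m+kn]%n≡m%n c (suc (m / n)) n ⟨
    (c + suc (m / n) * n) % n    ≡⟨ cong (λ y → (c + y) % n) m+x≡[1+m/n]*n ⟨
    (c + (m + x)) % n            ≡⟨ cong (_% n) (swap c m x) ⟩
    (x + (m + c)) % n            ≡⟨ cong (λ y → (x + y) % n) m+c≡q*n ⟩
    (x + q * n) % n              ≡⟨ [m+kn]%n≡m%n x q n ⟩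
    x % n                        ∎
    where
    open ≡-Reasoning
    x : ℕ
    x = n ∸ m % n
    swap : ∀ a b c → a + (b + c) ≡ c + (b + a)
    swap = solve-∀
    rotate : ∀ a b c → a + b + c ≡ b + (a + c)
    rotate = solve-∀
    m+x≡[1+m/n]*n : m + x ≡ suc (m / n) * n
    m+x≡[1+m/n]*n = begin
      m + x                    ≡⟨ cong (_+ x) (m≡m%n+[m/n]*n m n) ⟩
      m % n + m / n * n + x    ≡⟨ rotate (m % n) (m / n * n) x ⟩
      m / n * n + (m % n + x)  ≡⟨ cong (m / n * n +_) (m+[n∸m]≡n (m%n≤n m n)) ⟩
      m / n * n + n            ≡⟨ +-comm (m / n * n) n ⟩
      suc (m / n) * n          ∎

  T-exponent : ∀ v {c d} → v < 6 → 3 ∣ 2 * v + c → 2 ∣ 3 * v + d → v ≡ T (c % 3) (d % 2)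
  T-exponent v {c} {d} v<6 3∣2v+c 2∣3v+d
    rewrite %-complement 3 (2 * v) c 3∣2v+c | %-complement 2 (3 * v) d 2∣3v+d = table v v<6
    where
    table : ∀ v → v < 6 → v ≡ T ((3 ∸ 2 * v % 3) % 3) ((2 ∸ 3 * v % 2) % 2)
    table 0 _ = refl
    table 1 _ = refl
    table 2 _ = refl
    table 3 _ = refl
    table 4 _ = refl
    table 5 _ = refl
    table (suc (suc (suc (suc (suc (suc _)))))) (s≤s (s≤s (s≤s (s≤s (s≤s (s≤s ()))))))

  SixthPowerFree : ℕ → Set
  SixthPowerFree s = ∀ {p} → Prime p → ¬ p ^ 6 ∣ s

  module _ (A B : ℕ) where

    Admissible : ℕ → Set
    Admissible s = IsPower 3 (s ^ 2 * A) × IsPower 2 (s ^ 3 * B)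

    admissible-seed : Admissible (A ^ 4 * B ^ 3)
    admissible-seed = (A ^ 3 * B ^ 2 , cube A B) , (A ^ 6 * B ^ 5 , square A B)
      where
      cube : ∀ a b → (a ^ 4 * b ^ 3) ^ 2 * a ≡ (a ^ 3 * b ^ 2) ^ 3
      cube = solve 2 (λ a b → (a :^ 4 :* b :^ 3) :^ 2 :* a := (a :^ 3 :* b :^ 2) :^ 3) refl
      square : ∀ a b → (a ^ 4 * b ^ 3) ^ 3 * b ≡ (a ^ 6 * b ^ 5) ^ 2
      square = solve 2 (λ a b → (a :^ 4 :* b :^ 3) :^ 3 :* b := (a :^ 6 :* b :^ 5) :^ 2) refl

    admissible-cancel⁶ : .{{NonZero m}} → Admissible (s * m ^ 6) → Admissible s
    admissible-cancel⁶ {m} {s} (cube , square) =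
      isPower-cancelʳ 3 {{_}} {{m^n≢0 m 4}} (subst (IsPower 3) (regroup-cube s m A) cube) ,
      isPower-cancelʳ 2 {{_}} {{m^n≢0 m 9}} (subst (IsPower 2) (regroup-square s m B) square)
      where
      regroup-cube : ∀ s m a → (s * m ^ 6) ^ 2 * a ≡ s ^ 2 * a * (m ^ 4) ^ 3
      regroup-cube = solve 3 (λ s m a → (s :* m :^ 6) :^ 2 :* a := s :^ 2 :* a :* (m :^ 4) :^ 3) refl
      regroup-square : ∀ s m b → (s * m ^ 6) ^ 3 * b ≡ s ^ 3 * b * (m ^ 9) ^ 2
      regroup-square = solve 3 (λ s m b → (s :* m :^ 6) :^ 3 :* b := s :^ 3 :* b :* (m :^ 9) :^ 2) refl

    admissible⇒sixthPowerFree-admissible : {{NonZero s}} → Admissible s →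
                                ∃[ t ] NonZero t × Admissible t × SixthPowerFree t
    admissible⇒sixthPowerFree-admissible {s} = <-rec (λ s → {{NonZero s}} → Admissible s → _) descend s
      where
      descend : ∀ s → (∀ {r} → r < s → {{NonZero r}} → Admissible r →
                        ∃[ t ] NonZero t × Admissible t × SixthPowerFree t) →
                {{NonZero s}} → Admissible s → ∃[ t ] NonZero t × Admissible t × SixthPowerFree t
      descend s smaller {{s≢0}} adm with anyUpTo? (λ p → prime? p ×-dec p ^ 6 ∣? s) (suc s)
      ... | no no-sixth-power = s , s≢0 , adm , λ {p} pp p^6∣s →
        no-sixth-power (p , s≤s (∣⇒≤ (∣-trans (m∣m*n (p ^ 5)) p^6∣s)) , pp , p^6∣s)
      ... | yes (p , _ , pp , divides r s≡r*p^6) =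
        smaller r<s {{r≢0}} (admissible-cancel⁶ {p} {r} {{prime⇒nonZero pp}} (subst Admissible s≡r*p^6 adm))
        where
        r≢0 : NonZero r
        r≢0 = m*n≢0⇒m≢0 r {{subst NonZero s≡r*p^6 s≢0}}
        p^6>1 : 1 < p ^ 6
        p^6>1 = ^-monoʳ-< p (nonTrivial⇒n>1 p {{prime⇒nonTrivial pp}}) {0} {6} z<s
        r<s : r < s
        r<s = subst (r <_) (sym s≡r*p^6) (m<m*n r (p ^ 6) {{r≢0}} p^6>1)

    admissible-exponent : ∀ {c d} → .{{NonZero s}} → Admissible s → SixthPowerFree s → Prime p →
                          IsExponent p c A → IsExponent p d B → IsExponent p (T (c % 3) (d % 2)) s
    admissible-exponent {s} {p} {c} {d} (cube , square) sixthPowerFree pp c-exp d-exp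
      with exponent-exists pp s
    ... | v , v-exp = subst (λ e → IsExponent p e s) (T-exponent v v<6 3∣2v+c 2∣3v+d) v-exp
      where
      3∣2v+c : 3 ∣ 2 * v + c
      3∣2v+c = isPower⇒∣exponent 3 pp cube (isExponent-* pp {2 * v} (isExponent-^ pp {v} v-exp 2) c-exp)
      2∣3v+d : 2 ∣ 3 * v + d
      2∣3v+d = isPower⇒∣exponent 2 pp square (isExponent-* pp {3 * v} (isExponent-^ pp {v} v-exp 3) d-exp)
      v<6 : v < 6
      v<6 with v <? 6
      ... | yes v<6 = v<6
      ... | no  v≮6 = contradiction (isExponent-∣ v-exp (≮⇒≥ v≮6)) (sixthPowerFree pp)

    admissible-unique : .{{NonZero A}} → .{{NonZero B}} → .{{NonZero s}} → .{{NonZero t}} →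
                        Admissible s → SixthPowerFree s → Admissible t → SixthPowerFree t → s ≡ t
    admissible-unique adm-s free-s adm-t free-t =
      ∣-antisym (admissible-∣ adm-s free-s adm-t free-t) (admissible-∣ adm-t free-t adm-s free-s)
      where
      admissible-∣ : .{{NonZero s}} → .{{NonZero t}} →
                     Admissible s → SixthPowerFree s → Admissible t → SixthPowerFree t → s ∣ t
      admissible-∣ adm-s free-s adm-t free-t = prime-powers-∣⇒∣ λ {p} {e} pp p^e∣s →
        let c , c-exp = exponent-exists pp A
            d , d-exp = exponent-exists pp B
            v = T (c % 3) (d % 2)
        in isExponent-∣ {e = v} {g = e} (admissible-exponent {c = c} {d} adm-t free-t pp c-exp d-exp)
             (isExponent-maximal {e = v} {g = e} (admissible-exponent {c = c} {d} adm-s free-s pp c-exp d-exp) p^e∣s)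

module _ where
  open import Data.Nat as ℕ using (ℕ; NonZero; zero; suc; _%_)
  import Data.Nat.Properties as ℕ
  import Data.Nat.Divisibility as ℕ
  open import Data.Nat.Coprimality using (coprime-divisor; gcd≡1⇒coprime)
  import Data.Nat.Coprimality as Coprime
  open import Data.Nat.GCD using (gcd; gcd-greatest; c*gcd[m,n]≡gcd[cm,cn])
  open import Data.Integer using (ℤ; +_; -[1+_]; ∣_∣; _+_; _*_; _^_; _<_; +<+)
  open import Data.Integer.Properties using (pos-+; pos-*; ∣i*j∣≡∣i∣*∣j∣; +-injective)
  open import Data.Integer.Divisibility using (_∣_)
  open import Data.Product using (∃-syntax; _×_; _,_)
  open import Data.Nat.Primality using (Prime)
  open import Relation.Binary.PropositionalEquality

  private variable k m n s t : ℕ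

  pos-^ : ∀ m n → + (m ℕ.^ n) ≡ (+ m) ^ n
  pos-^ m zero    = refl
  pos-^ m (suc n) = trans (pos-* m (m ℕ.^ n)) (cong (+ m *_) (pos-^ m n))

  ∣i^n∣≡∣i∣^n : ∀ i n → ∣ i ^ n ∣ ≡ ∣ i ∣ ℕ.^ n
  ∣i^n∣≡∣i∣^n i zero    = refl
  ∣i^n∣≡∣i∣^n i (suc n) = trans (∣i*j∣≡∣i∣*∣j∣ i (i ^ n)) (cong (∣ i ∣ ℕ.*_) (∣i^n∣≡∣i∣^n i n))

  isPower⇒ℤ-power : ∀ k → IsPower k n → ∃[ x ] + n ≡ x ^ k
  isPower⇒ℤ-power k (x , n≡x^k) = + x , trans (cong +_ n≡x^k) (pos-^ x k)

  ℤ-power⇒isPower : ∀ k x → + n ≡ x ^ k → IsPower k n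
  ℤ-power⇒isPower k x n≡x^k = ∣ x ∣ , trans (cong ∣_∣ n≡x^k) (∣i^n∣≡∣i∣^n x k)

  ℤ-pow∣⇒pow∣ : ∀ p k → (+ p) ^ k ∣ + n → p ℕ.^ k ℕ.∣ n
  ℤ-pow∣⇒pow∣ p k = subst (ℕ._∣ _) (∣i^n∣≡∣i∣^n (+ p) k)

  pow∣⇒ℤ-pow∣ : ∀ p k → p ℕ.^ k ℕ.∣ n → (+ p) ^ k ∣ + n
  pow∣⇒ℤ-pow∣ p k = subst (ℕ._∣ _) (sym (∣i^n∣≡∣i∣^n (+ p) k))

  proportional⇒multiple : ∀ {u} k .{{_ : NonZero k}} → gcd u k ≡ 1 → ∀ {a b} → + 0 < b → a * + k ≡ + u * b →
                          ∃[ s ] NonZero s × a ≡ + (u ℕ.* s) × b ≡ + (k ℕ.* s)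
  proportional⇒multiple {u} (suc _) _ { -[1+ _ ]} {+ b} _ ak≡ub with trans ak≡ub (sym (pos-* u b))
  ... | ()
  proportional⇒multiple {u} k gcd≡1 {+ a} {+ b} (+<+ 0<b) ak≡ub =
    q , q≢0 , cong +_ a≡uq , cong +_ (trans b≡qk (ℕ.*-comm q k))
    where
    ak≡ub′ : a ℕ.* k ≡ u ℕ.* b
    ak≡ub′ = +-injective (trans (pos-* a k) (trans ak≡ub (sym (pos-* u b))))
    k∣b : k ℕ.∣ b
    k∣b = coprime-divisor (Coprime.sym (gcd≡1⇒coprime {u} gcd≡1)) (ℕ.divides a (sym ak≡ub′))
    q : ℕ
    q = ℕ.quotient k∣b
    b≡qk : b ≡ q ℕ.* k
    b≡qk = ℕ.m∣n⇒n≡quotient*m k∣b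
    q≢0 : NonZero q
    q≢0 = ℕ.m*n≢0⇒m≢0 q {{subst NonZero b≡qk (ℕ.>-nonZero 0<b)}}
    a≡uq : a ≡ u ℕ.* q
    a≡uq = ℕ.*-cancelʳ-≡ a (u ℕ.* q) k
             (trans ak≡ub′ (trans (cong (u ℕ.*_) b≡qk) (sym (ℕ.*-assoc u q k))))

  module _ (u k : ℕ) where

    private
      A B : ℕ
      A = u ℕ.^ 2 ℕ.+ k ℕ.^ 2
      B = u ℕ.^ 3 ℕ.+ k ℕ.^ 3

    scaled-ℤ-power-sum : ∀ n s → (+ (u ℕ.* s)) ^ n + (+ (k ℕ.* s)) ^ n ≡ + (s ℕ.^ n ℕ.* (u ℕ.^ n ℕ.+ k ℕ.^ n))
    scaled-ℤ-power-sum n s = begin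
      (+ (u ℕ.* s)) ^ n + (+ (k ℕ.* s)) ^ n        ≡⟨ cong₂ _+_ (pos-^ (u ℕ.* s) n) (pos-^ (k ℕ.* s) n) ⟨
      + ((u ℕ.* s) ℕ.^ n) + + ((k ℕ.* s) ℕ.^ n)    ≡⟨ pos-+ ((u ℕ.* s) ℕ.^ n) ((k ℕ.* s) ℕ.^ n) ⟨
      + ((u ℕ.* s) ℕ.^ n ℕ.+ (k ℕ.* s) ℕ.^ n)      ≡⟨ cong +_ (scaled-power-sum n u k s) ⟩
      + (s ℕ.^ n ℕ.* (u ℕ.^ n ℕ.+ k ℕ.^ n))        ∎
      where open ≡-Reasoning

    admissible⇒bhaskaraPair : Admissible A B s → BhaskaraPair (+ (u ℕ.* s)) (+ (k ℕ.* s))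
    admissible⇒bhaskaraPair {s} (cube , square) with isPower⇒ℤ-power 3 cube | isPower⇒ℤ-power 2 square
    ... | x , x³ | y , y² = x , y , trans (scaled-ℤ-power-sum 2 s) x³ , trans (scaled-ℤ-power-sum 3 s) y²

    bhaskaraPair⇒admissible : BhaskaraPair (+ (u ℕ.* s)) (+ (k ℕ.* s)) → Admissible A B s
    bhaskaraPair⇒admissible {s} (x , y , x³ , y²) =
      ℤ-power⇒isPower 3 x (trans (sym (scaled-ℤ-power-sum 2 s)) x³) ,
      ℤ-power⇒isPower 2 y (trans (sym (scaled-ℤ-power-sum 3 s)) y²)

    sixthPowerFree⇒fundamental : gcd u k ≡ 1 → SixthPowerFree s → Fundamental (+ (u ℕ.* s)) (+ (k ℕ.* s))
    sixthPowerFree⇒fundamental {s} gcd≡1 free (p , pp , p⁶∣us , p⁶∣ks) =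
      free pp (subst (p ℕ.^ 6 ℕ.∣_) gcd[us,ks]≡s
                (gcd-greatest (ℤ-pow∣⇒pow∣ p 6 p⁶∣us) (ℤ-pow∣⇒pow∣ p 6 p⁶∣ks)))
      where
      gcd[us,ks]≡s : gcd (u ℕ.* s) (k ℕ.* s) ≡ s
      gcd[us,ks]≡s = begin
        gcd (u ℕ.* s) (k ℕ.* s)  ≡⟨ cong₂ gcd (ℕ.*-comm u s) (ℕ.*-comm k s) ⟩
        gcd (s ℕ.* u) (s ℕ.* k)  ≡⟨ c*gcd[m,n]≡gcd[cm,cn] s u k ⟨
        s ℕ.* gcd u k            ≡⟨ cong (s ℕ.*_) gcd≡1 ⟩
        s ℕ.* 1                  ≡⟨ ℕ.*-identityʳ s ⟩
        s                        ∎
        where open ≡-Reasoning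

    fundamental⇒sixthPowerFree : Fundamental (+ (u ℕ.* s)) (+ (k ℕ.* s)) → SixthPowerFree s
    fundamental⇒sixthPowerFree fundamental {p} pp p⁶∣s =
      fundamental (p , pp , pow∣⇒ℤ-pow∣ p 6 (ℕ.∣-trans p⁶∣s (ℕ.n∣m*n u)) ,
                            pow∣⇒ℤ-pow∣ p 6 (ℕ.∣-trans p⁶∣s (ℕ.n∣m*n k)))

    multiple⇒proportional : ∀ s → + (u ℕ.* s) * + k ≡ + u * + (k ℕ.* s)
    multiple⇒proportional s = begin
      + (u ℕ.* s) * + k      ≡⟨ pos-* (u ℕ.* s) k ⟨
      + (u ℕ.* s ℕ.* k)      ≡⟨ cong +_ (ℕ.*-assoc u s k) ⟩
      + (u ℕ.* (s ℕ.* k))    ≡⟨ cong (λ r → + (u ℕ.* r)) (ℕ.*-comm s k) ⟩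
      + (u ℕ.* (k ℕ.* s))    ≡⟨ pos-* u (k ℕ.* s) ⟩
      + u * + (k ℕ.* s)      ∎
      where open ≡-Reasoning

    private
      powerSum≢0 : ∀ n → .{{NonZero k}} → NonZero (u ℕ.^ n ℕ.+ k ℕ.^ n)
      powerSum≢0 n = ℕ.>-nonZero (ℕ.<-≤-trans (ℕ.m^n>0 k n) (ℕ.m≤n+m (k ℕ.^ n) (u ℕ.^ n)))

    fundamental-multiple-exists : .{{NonZero k}} → gcd u k ≡ 1 →
                                  ∃[ t ] NonZero t × FundamentalBhaskaraPair (+ (u ℕ.* t)) (+ (k ℕ.* t))
    fundamental-multiple-exists gcd≡1 with admissible⇒sixthPowerFree-admissible A B {{seed≢0}} (admissible-seed A B)
      where
      seed≢0 : NonZero (A ℕ.^ 4 ℕ.* B ℕ.^ 3)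
      seed≢0 = ℕ.m*n≢0 _ _ {{ℕ.m^n≢0 A 4 {{powerSum≢0 2}}}} {{ℕ.m^n≢0 B 3 {{powerSum≢0 3}}}}
    ... | t , t≢0 , adm , free =
      t , t≢0 , admissible⇒bhaskaraPair adm , sixthPowerFree⇒fundamental gcd≡1 free

    fundamental-multiple-unique : .{{NonZero k}} → gcd u k ≡ 1 → .{{NonZero t}} →
                                  FundamentalBhaskaraPair (+ (u ℕ.* t)) (+ (k ℕ.* t)) →
                                  (a b : ℤ) → FundamentalBhaskaraPair a b → + 0 < b → a * + k ≡ + u * b →
                                  a ≡ + (u ℕ.* t) × b ≡ + (k ℕ.* t)
    fundamental-multiple-unique {t} gcd≡1 (pair-t , fundamental-t) a b (pair-s , fundamental-s) b>0 ak≡ub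
      with proportional⇒multiple {u} k gcd≡1 {a} {b} b>0 ak≡ub
    ... | s , s≢0 , refl , refl = cong (λ r → + (u ℕ.* r)) s≡t , cong (λ r → + (k ℕ.* r)) s≡t
      where
      s≡t : s ≡ t
      s≡t = admissible-unique A B {{powerSum≢0 2}} {{powerSum≢0 3}} {{s≢0}}
              (bhaskaraPair⇒admissible pair-s) (fundamental⇒sixthPowerFree fundamental-s)
              (bhaskaraPair⇒admissible pair-t) (fundamental⇒sixthPowerFree fundamental-t)

    fundamental-multiple-exponent : .{{NonZero t}} → FundamentalBhaskaraPair (+ (u ℕ.* t)) (+ (k ℕ.* t)) →
                                    ∀ {p c d e} → Prime p → IsExponent p c A → IsExponent p d B →
                                    IsExponent p e k → IsExponent p (e ℕ.+ T (c % 3) (d % 2)) (k ℕ.* t)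
    fundamental-multiple-exponent (pair , fundamental) {c = c} {d} {e} pp c-exp d-exp e-exp =
      isExponent-* pp {e = e} {f = T (c % 3) (d % 2)} e-exp
        (admissible-exponent A B {c = c} {d} (bhaskaraPair⇒admissible pair)
                             (fundamental⇒sixthPowerFree fundamental) pp c-exp d-exp)

open import Data.Nat using (ℕ; _≤_; _%_)
open import Data.Nat.GCD using (gcd)
open import Data.Nat.Primality using (Prime)
open import Data.Integer using (ℤ; +_; _*_; _<_; ∣_∣)
open import Data.Integer.Divisibility using (_∣_)
open import Data.Product using (Σ; _×_; _,_)
open import Relation.Binary.PropositionalEquality using (_≡_)
import Data.Nat as ℕ
import Data.Nat.Properties as ℕ
import Data.Nat.Divisibility as ℕ
open import Data.Integer using (+<+)
open import Function using (case_of_)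

theorem3p8 : (u k : ℕ) → u ≤ k → 1 ≤ k → gcd u k ≡ 1 →
    Σ (ℤ × ℤ) λ { (a , b) →
      -- existence: {a,b} fundamental Bhaskara pair, b > 0, a/b = u/k
      (FundamentalBhaskaraPair a b × (+ 0 < b) × (a * + k ≡ + u * b))
      -- uniqueness
      × ((a′ b′ : ℤ) → FundamentalBhaskaraPair a′ b′ → + 0 < b′ →
           a′ * + k ≡ + u * b′ → (a′ ≡ a × b′ ≡ b))
      -- explicit form: b = ∏_p p^(k_p + T(c_p mod 3, d_p mod 2)), k ∣ b
      × ((p c d e : ℕ) → Prime p →
           IsExponent p c (u Data.Nat.^ 2 Data.Nat.+ k Data.Nat.^ 2) →
           IsExponent p d (u Data.Nat.^ 3 Data.Nat.+ k Data.Nat.^ 3) →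
           IsExponent p e k →
           IsExponent p (e Data.Nat.+ T (c % 3) (d % 2)) ∣ b ∣)
      × (+ k ∣ b) }
theorem3p8 u k _ 1≤k gcd≡1 = case fundamental-multiple-exists u k gcd≡1 of λ
  { (t , t≢0 , pair) →
    (+ (u ℕ.* t) , + (k ℕ.* t)) ,
    (pair , +<+ (ℕ.>-nonZero⁻¹ (k ℕ.* t) {{ℕ.m*n≢0 k t {{k≢0}} {{t≢0}}}}) , multiple⇒proportional u k t) ,
    fundamental-multiple-unique u k gcd≡1 {{t≢0}} pair ,
    (λ p c d e → fundamental-multiple-exponent u k {{t≢0}} pair {p} {c} {d} {e}) ,
    ℕ.m∣m*n t }
  where
  instance
    k≢0 : ℕ.NonZero k
    k≢0 = ℕ.>-nonZero 1≤k
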